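{- There exists a set $W \subseteq \mathbb{Z}$ such that $W + W = \mathbb{Z}$ and $W$ contains no 3-term arithmetic progression (i.e. there are no $w \in W$ and integer $d \neq 0$ with $w-d, w, w+d \in W$).
   Context: $W + W = \{w_1 + w_2 : w_1, w_2 \in W\}$. -}

module Defs where

open import Level using (0ℓ)
open import Data.Integer using (ℤ; _+_; _-_; 0ℤ)
open import Data.Product using (Σ; ∃; _×_; ∃-syntax)
open import Relation.Binary.PropositionalEquality using (_≡_)
open import Relation.Nullary using (¬_)
open import Data.Empty using (⊥)
open import Relation.Unary using (Pred; _∈_)

SumsetIsAll : Pred ℤ 0ℓ → Set
SumsetIsAll W = ∀ (n : ℤ) → ∃[ w₁ ] ∃[ w₂ ] (w₁ ∈ W × w₂ ∈ W × w₁ + w₂ ≡ n)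

No3AP : Pred ℤ 0ℓ → Set
No3AP W = ∀ (w d : ℤ) → ¬ (d ≡ 0ℤ) → w - d ∈ W → w ∈ W → w + d ∈ W → ⊥

-- Let A be the set of naturals whose base-3 digits are all 0 or 1. Adding two
-- elements of A digit by digit produces no carries, so a + c = b + b forces
-- the digits of a and c to agree: A has no 3-term progression. Splitting each
-- digit 0, 1, 2 as 0 + 0, 1 + 0, 1 + 1 writes every n as a sum a + c of
-- elements of A, and a digit 2 = 3 − 1 with a borrow writes every n as a
-- difference a − c. Take W = 2A ∪ (−1 − 2A). The two parts have opposite
-- parity, so a progression x + z = 2y in W lies in one part and halves to a
-- progression in A. Even integers are sums 2a + 2c or (−1 − 2a) + (−1 − 2c),
-- and odd ones are mixed sums 2a + (−1 − 2c) = 2(a − c) − 1.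
module Submission where

open import Defs
open import Level using (0ℓ)
open import Data.Integer using (ℤ)
open import Data.Product using (Σ; _×_)
open import Relation.Unary using (Pred; _∈_)

open import Data.Empty using (⊥-elim)
open import Data.Integer using (+_; -[1+_]; _⊖_; -_; _-_; 0ℤ; -1ℤ)
  renaming (_+_ to _+ℤ_; _*_ to _*ℤ_)
open import Data.Integer.Properties as ℤ
  using (+-0-abelianGroup; ⊖-≥; ⊖-swap; pos-*; neg-suc; +-inverseʳ; -[1+-injective; +-injective)
open import Algebra.Properties.AbelianGroup +-0-abelianGroup using (∙-cancelˡ)
import Data.Integer.Tactic.RingSolver as ℤ-Solver
open import Data.Nat using (ℕ; zero; suc; _+_; _*_; _<_; z≤n; s≤s)
open import Data.Nat.Properties
open import Data.Nat.DivMod using (_%_; _divMod_; module DivMod; result; m/n<m; m<n⇒m%n≡m; [m+kn]%n≡m%n)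
open import Data.Nat.Induction using (<-rec)
open import Data.Nat.Tactic.RingSolver using (solve-∀)
open import Data.Fin using (Fin; zero; suc; toℕ)
open import Data.Fin.Properties using (toℕ≤pred[n])
open import Data.Product using (_,_; proj₁; ∃-syntax; Σ-syntax)
open import Data.Sum using (inj₁; inj₂; _⊎_)
open import Relation.Binary.PropositionalEquality
  using (_≡_; _≢_; refl; sym; trans; cong; cong₂; subst; module ≡-Reasoning)
open ≡-Reasoning

base3-rec : (P : ℕ → Set) → P 0 → (∀ q (r : Fin 3) → P q → P (toℕ r + q * 3)) → ∀ n → P n
base3-rec P base step = <-rec P go
  where
  go : ∀ n → (∀ {m} → m < n → P m) → P n
  go zero    _   = base
  go n@(suc _) rec = subst P (sym property) (step quotient remainder (rec (m/n<m n 3 (s≤s (s≤s z≤n)))))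
    where open DivMod (n divMod 3)

base3-unique : ∀ {r s x y} → r < 3 → s < 3 → r + x * 3 ≡ s + y * 3 → r ≡ s × x ≡ y
base3-unique {r} {s} {x} {y} r<3 s<3 eq =
  r≡s , *-cancelʳ-≡ x y 3 (+-cancelˡ-≡ r _ _ (trans eq (cong (_+ y * 3) (sym r≡s))))
  where
  r≡s : r ≡ s
  r≡s = begin
    r               ≡⟨ m<n⇒m%n≡m r<3 ⟨
    r % 3           ≡⟨ [m+kn]%n≡m%n r x 3 ⟨
    (r + x * 3) % 3 ≡⟨ cong (_% 3) eq ⟩
    (s + y * 3) % 3 ≡⟨ [m+kn]%n≡m%n s y 3 ⟩
    s % 3           ≡⟨ m<n⇒m%n≡m s<3 ⟩
    s               ∎

+-digitwise : ∀ r x s y → (r + x * 3) + (s + y * 3) ≡ (r + s) + (x + y) * 3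
+-digitwise = solve-∀

bit-sum<3 : (d e : Fin 2) → toℕ d + toℕ e < 3
bit-sum<3 d e = s≤s (+-mono-≤ (toℕ≤pred[n] d) (toℕ≤pred[n] e))

bit-midpoint : (d e f : Fin 2) → toℕ d + toℕ e ≡ toℕ f + toℕ f → d ≡ e
bit-midpoint zero       zero       _          _  = refl
bit-midpoint (suc zero) (suc zero) _          _  = refl
bit-midpoint zero       (suc zero) zero       ()
bit-midpoint zero       (suc zero) (suc zero) ()
bit-midpoint (suc zero) zero       zero       ()
bit-midpoint (suc zero) zero       (suc zero) ()

bits-summing-to : (r : Fin 3) → Σ[ d ∈ Fin 2 ] Σ[ e ∈ Fin 2 ] (toℕ d + toℕ e ≡ toℕ r)
bits-summing-to zero             = zero , zero , refl
bits-summing-to (suc zero)       = suc zero , zero , refl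
bits-summing-to (suc (suc zero)) = suc zero , suc zero , refl

data Ternary01 : ℕ → Set where
  []  : Ternary01 0
  _∷_ : ∀ {n} (d : Fin 2) → Ternary01 n → Ternary01 (toℕ d + n * 3)

lastDigit : ∀ {n} → Ternary01 n → Σ[ d ∈ Fin 2 ] ∃[ m ] (Ternary01 m × n ≡ toℕ d + m * 3)
lastDigit []      = zero , 0 , [] , refl
lastDigit (d ∷ p) = d , _ , p , refl

ternary01-midpoint : ∀ {a b c} → Ternary01 a → Ternary01 b → Ternary01 c → a + c ≡ b + b → a ≡ c
ternary01-midpoint {a} _ [] _ eq = trans (m+n≡0⇒m≡0 a eq) (sym (m+n≡0⇒n≡0 a eq))
ternary01-midpoint pa (_∷_ {b} f pb) pc eq with lastDigit pa | lastDigit pc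
... | d , a , pa′ , refl | e , c , pc′ , refl
  with base3-unique (bit-sum<3 d e) (bit-sum<3 f f)
         (trans (sym (+-digitwise (toℕ d) a (toℕ e) c)) (trans eq (+-digitwise (toℕ f) b (toℕ f) b)))
... | d+e≡f+f , a+c≡b+b =
  cong₂ (λ r m → toℕ r + m * 3) (bit-midpoint d e f d+e≡f+f) (ternary01-midpoint pa′ pb pc′ a+c≡b+b)

Ternary01Sum : ℕ → Set
Ternary01Sum n = ∃[ a ] ∃[ c ] (Ternary01 a × Ternary01 c × a + c ≡ n)

Ternary01Diff : ℕ → Set
Ternary01Diff n = ∃[ a ] ∃[ c ] (Ternary01 a × Ternary01 c × a ≡ n + c)

ternary01-sums : ∀ n → Ternary01Sum n
ternary01-sums = base3-rec Ternary01Sum (0 , 0 , [] , [] , refl) step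
  where
  step : ∀ q r → Ternary01Sum q → Ternary01Sum (toℕ r + q * 3)
  step _ r (a , c , pa , pc , refl) with bits-summing-to r
  ... | d , e , d+e≡r = _ , _ , d ∷ pa , e ∷ pc ,
    trans (+-digitwise (toℕ d) a (toℕ e) c) (cong (_+ (a + c) * 3) d+e≡r)

diff-digit : ∀ {q} (d : Fin 2) → Ternary01Diff q → Ternary01Diff (toℕ d + q * 3)
diff-digit {q} d (a , c , pa , pc , refl) = _ , _ , d ∷ pa , zero ∷ pc , shift (toℕ d) q c
  where
  shift : ∀ r q c → r + (q + c) * 3 ≡ (r + q * 3) + c * 3
  shift = solve-∀

diff-borrow : ∀ {q} → Ternary01Diff (suc q) → Ternary01Diff (2 + q * 3)
diff-borrow {q} (a , c , pa , pc , refl) = _ , _ , zero ∷ pa , suc zero ∷ pc , borrow q c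
  where
  borrow : ∀ q c → (suc q + c) * 3 ≡ (2 + q * 3) + (1 + c * 3)
  borrow = solve-∀

-- A borrow at digit 2 needs a difference for q + 1, so n and n + 1 are built together.
ternary01-diffs : ∀ n → Ternary01Diff n
ternary01-diffs n = proj₁ (base3-rec (λ n → Ternary01Diff n × Ternary01Diff (suc n)) base step n)
  where
  base : Ternary01Diff 0 × Ternary01Diff 1
  base = (0 , 0 , [] , [] , refl) , (1 , 0 , suc zero ∷ [] , [] , refl)
  step : ∀ q r → Ternary01Diff q × Ternary01Diff (suc q) →
         Ternary01Diff (toℕ r + q * 3) × Ternary01Diff (suc (toℕ r + q * 3))
  step _ zero             (Dq , Dq+1) = diff-digit zero Dq , diff-digit (suc zero) Dq
  step _ (suc zero)       (Dq , Dq+1) = diff-digit (suc zero) Dq , diff-borrow Dq+1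
  step _ (suc (suc zero)) (Dq , Dq+1) = diff-borrow Dq+1 , diff-digit zero Dq+1

-i≡i⇒i≡0 : ∀ {i} → - i ≡ i → i ≡ 0ℤ
-i≡i⇒i≡0 {+ zero}   _ = refl
-i≡i⇒i≡0 {+ suc _}  ()
-i≡i⇒i≡0 { -[1+ _ ]} ()

[m+n]⊖m≡+n : ∀ m n → (m + n) ⊖ m ≡ + n
[m+n]⊖m≡+n m n = trans (⊖-≥ (m≤m+n m n)) (cong +_ (m+n∸m≡n m n))

m⊖[m+n]≡-n : ∀ m n → m ⊖ (m + n) ≡ - + n
m⊖[m+n]≡-n m n = trans (⊖-swap m (m + n)) (cong -_ ([m+n]⊖m≡+n m n))

double-sum : ∀ a c {k} → a + c ≡ k → a * 2 + c * 2 ≡ k * 2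
double-sum a c a+c≡k = trans (sym (*-distribʳ-+ 2 a c)) (cong (_* 2) a+c≡k)

double≢-1 : ∀ t → t +ℤ t ≢ -1ℤ
double≢-1 (+ _)    ()
double≢-1 -[1+ _ ] ()

even+odd≢double : ∀ a c y → + (a * 2) +ℤ -[1+ c * 2 ] ≢ y +ℤ y
even+odd≢double a c y eq = double≢-1 (y - + a +ℤ + c) (begin
  (y - + a +ℤ + c) +ℤ (y - + a +ℤ + c)                        ≡⟨ rearrange y (+ a) (+ c) ⟩
  (y +ℤ y) - (+ a *ℤ + 2 +ℤ (-1ℤ +ℤ - (+ c *ℤ + 2))) +ℤ -1ℤ   ≡⟨ cong (λ s → (y +ℤ y) - s +ℤ -1ℤ) even+odd ⟨
  (y +ℤ y) - (+ (a * 2) +ℤ -[1+ c * 2 ]) +ℤ -1ℤ               ≡⟨ cong (λ s → (y +ℤ y) - s +ℤ -1ℤ) eq ⟩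
  (y +ℤ y) - (y +ℤ y) +ℤ -1ℤ                                  ≡⟨ cong (_+ℤ -1ℤ) (+-inverseʳ (y +ℤ y)) ⟩
  -1ℤ                                                         ∎)
  where
  rearrange : ∀ y a c → (y - a +ℤ c) +ℤ (y - a +ℤ c) ≡ (y +ℤ y) - (a *ℤ + 2 +ℤ (-1ℤ +ℤ - (c *ℤ + 2))) +ℤ -1ℤ
  rearrange = ℤ-Solver.solve-∀
  even+odd : + (a * 2) +ℤ -[1+ c * 2 ] ≡ + a *ℤ + 2 +ℤ (-1ℤ +ℤ - (+ c *ℤ + 2))
  even+odd = cong₂ _+ℤ_ (pos-* a 2) (trans (neg-suc (c * 2)) (cong (λ k → -1ℤ +ℤ - k) (pos-* c 2)))

W : Pred ℤ 0ℓ
W w = ∃[ a ] (Ternary01 a × (w ≡ + (a * 2) ⊎ w ≡ -[1+ a * 2 ]))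

W-midpoint : ∀ {x y z} → W x → W y → W z → x +ℤ z ≡ y +ℤ y → x ≡ z
W-midpoint (a , pa , inj₁ refl) (b , pb , inj₁ refl) (c , pc , inj₁ refl) eq =
  cong (λ t → + (t * 2)) (ternary01-midpoint pa pb pc (*-cancelʳ-≡ _ _ 2 halves))
  where
  halves : (a + c) * 2 ≡ (b + b) * 2
  halves = trans (*-distribʳ-+ 2 a c) (trans (+-injective eq) (sym (*-distribʳ-+ 2 b b)))
W-midpoint (a , pa , inj₂ refl) (b , pb , inj₂ refl) (c , pc , inj₂ refl) eq =
  cong (λ t → -[1+ t * 2 ]) (ternary01-midpoint pa pb pc (*-cancelʳ-≡ _ _ 2 halves))
  where
  halves : (a + c) * 2 ≡ (b + b) * 2
  halves = trans (*-distribʳ-+ 2 a c) (trans (suc-injective (-[1+-injective eq)) (sym (*-distribʳ-+ 2 b b)))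
W-midpoint (_ , _ , inj₁ refl) (_ , _ , inj₂ refl) (_ , _ , inj₁ refl) ()
W-midpoint (_ , _ , inj₂ refl) (_ , _ , inj₁ refl) (_ , _ , inj₂ refl) ()
W-midpoint {y = y} (a , _ , inj₁ refl) _ (c , _ , inj₂ refl) eq = ⊥-elim (even+odd≢double a c y eq)
W-midpoint {y = y} (a , _ , inj₂ refl) _ (c , _ , inj₁ refl) eq =
  ⊥-elim (even+odd≢double c a y (trans (ℤ.+-comm (+ (c * 2)) -[1+ a * 2 ]) eq))

W-no3AP : No3AP W
W-no3AP w d d≢0 w-d∈W w∈W w+d∈W =
  d≢0 (-i≡i⇒i≡0 (∙-cancelˡ w (- d) d (W-midpoint w-d∈W w∈W w+d∈W (outer-sum w d))))
  where
  outer-sum : ∀ w d → (w - d) +ℤ (w +ℤ d) ≡ w +ℤ w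
  outer-sum = ℤ-Solver.solve-∀

W+W : Pred ℤ 0ℓ
W+W n = ∃[ w₁ ] ∃[ w₂ ] (w₁ ∈ W × w₂ ∈ W × w₁ +ℤ w₂ ≡ n)

+even∈W+W : ∀ k → + (k * 2) ∈ W+W
+even∈W+W k with ternary01-sums k
... | a , c , pa , pc , a+c≡k = _ , _ , (a , pa , inj₁ refl) , (c , pc , inj₁ refl) , cong +_ (double-sum a c a+c≡k)

-even∈W+W : ∀ k → -[1+ suc (k * 2) ] ∈ W+W
-even∈W+W k with ternary01-sums k
... | a , c , pa , pc , a+c≡k =
  _ , _ , (a , pa , inj₂ refl) , (c , pc , inj₂ refl) , cong (λ t → -[1+ suc t ]) (double-sum a c a+c≡k)

+odd∈W+W : ∀ k → + suc (k * 2) ∈ W+W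
+odd∈W+W k with ternary01-diffs (suc k)
... | _ , c , pa , pc , refl = _ , _ , (_ , pa , inj₁ refl) , (c , pc , inj₂ refl) , (begin
  (suc k + c) * 2 ⊖ suc (c * 2)              ≡⟨ cong (_⊖ suc (c * 2)) (regroup k c) ⟩
  (suc (c * 2) + suc (k * 2)) ⊖ suc (c * 2)  ≡⟨ [m+n]⊖m≡+n (suc (c * 2)) (suc (k * 2)) ⟩
  + suc (k * 2)                              ∎)
  where
  regroup : ∀ k c → (suc k + c) * 2 ≡ suc (c * 2) + suc (k * 2)
  regroup = solve-∀

-odd∈W+W : ∀ k → -[1+ k * 2 ] ∈ W+W
-odd∈W+W k with ternary01-diffs k
... | _ , c , pa , pc , refl = _ , _ , (c , pc , inj₁ refl) , (_ , pa , inj₂ refl) , (begin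
  c * 2 ⊖ suc ((k + c) * 2)      ≡⟨ cong (c * 2 ⊖_) (regroup k c) ⟩
  c * 2 ⊖ (c * 2 + suc (k * 2))  ≡⟨ m⊖[m+n]≡-n (c * 2) (suc (k * 2)) ⟩
  -[1+ k * 2 ]                   ∎)
  where
  regroup : ∀ k c → suc ((k + c) * 2) ≡ c * 2 + suc (k * 2)
  regroup = solve-∀

W-sumset : SumsetIsAll W
W-sumset (+ n) with n divMod 2
... | result k zero       refl = +even∈W+W k
... | result k (suc zero) refl = +odd∈W+W k
W-sumset -[1+ n ] with n divMod 2
... | result k zero       refl = -odd∈W+W k
... | result k (suc zero) refl = -even∈W+W k

proposition3 : Σ (Pred ℤ 0ℓ) (λ W → SumsetIsAll W × No3AP W)
proposition3 = W , W-sumset , W-no3AP
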